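{- For every positive integer $n$, the number of nonabsolute maximal sets of lanes (MSL) of the standard road intersection of size $n$ equals $M_n$.
   Context: For $n\ge 0$, $[n]=\{1,\dots,n\}$. A partition $\pi$ of $[n]$ is noncrossing if there are no two distinct blocks $A,B$ of $\pi$ and elements $a<b$ in $A$, $c<d$ in $B$ with $a<c<b<d$. A noncrossing partition $\pi$ of $[n]$ is a marriageable singles partition if it has two distinct singleton blocks $\{i\},\{j\}$ ($i\ne j$) such that replacing these two blocks by the block $\{i,j\}$ yields a noncrossing partition; $M_n$ is the number of marriageable singles partitions of $[n]$. The standard road intersection of size $n$ consists of $2n$ distinct points on a circle, labelled in clockwise order $E_1,X_1,E_2,X_2,\dots,E_n,X_n$ (entries $E_i$ and exits $X_i$ alternate). A lane is a straight chord $E_iX_j$ from an entry to an exit ($1\le i,j\le n$); a lane $E_iX_i$ is a U-turn. Two lanes cross if they have a common point (including a common endpoint). A maximal set of lanes (MSL) is a set of pairwise noncrossing lanes such that every further lane crosses at least one of them. An MSL is absolute if it does not contain two U-turns $E_iX_i$ and $E_jX_j$ ($i\ne j$) such that replacing them by the two lanes $E_iX_j$ and $E_jX_i$ yields another MSL; otherwise it is nonabsolute. -}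

module Defs where

open import Data.Nat as ℕ using (ℕ; _+_; _*_)
open import Data.Fin as Fin using (Fin; toℕ)
open import Data.Bool using (Bool; true; false; _∨_; _∧_; if_then_else_)
open import Data.Vec using (Vec; lookup; tabulate)
open import Data.List using (List; length)
open import Data.List.Membership.Propositional using (_∈_)
open import Data.List.Relation.Unary.Unique.Propositional using (Unique)
open import Data.Product using (Σ; ∃-syntax; _×_; _,_)
open import Data.Sum using (_⊎_)
open import Data.Empty using (⊥)
open import Relation.Nullary using (¬_)
open import Relation.Binary.PropositionalEquality using (_≡_; _≢_)
open import Relation.Nullary.Decidable using (⌊_⌋)
open import Function.Bundles using (_⇔_)

HasCard : {A : Set} → (A → Set) → ℕ → Set
HasCard {A} P k =
  Σ (List A) λ xs → Unique xs × (∀ x → (x ∈ xs) ⇔ P x) × length xs ≡ k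

-- Boolean n×n matrices: used both for binary relations on [n] (elements
-- are Fin n, i.e. 0-indexed) and for sets of lanes (entry i, exit j).
Mat : ℕ → Set
Mat n = Vec (Vec Bool n) n

_∋[_,_] : ∀ {n} → Mat n → Fin n → Fin n → Set
M ∋[ i , j ] = lookup (lookup M i) j ≡ true

-- Partitions of [n], represented as equivalence relations on [n]
-- (blocks = equivalence classes).

IsPartition : ∀ {n} → Mat n → Set
IsPartition {n} R =
  (∀ (a : Fin n) → R ∋[ a , a ]) ×
  (∀ (a b : Fin n) → R ∋[ a , b ] → R ∋[ b , a ]) ×
  (∀ (a b c : Fin n) → R ∋[ a , b ] → R ∋[ b , c ] → R ∋[ a , c ])

Noncrossing : ∀ {n} → Mat n → Set
Noncrossing {n} R =
  ∀ (a b c d : Fin n) → R ∋[ a , b ] → R ∋[ c , d ] → ¬ (R ∋[ a , c ]) →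
  a Fin.< c → c Fin.< b → b Fin.< d → ⊥

NoncrossingPartition : ∀ {n} → Mat n → Set
NoncrossingPartition R = IsPartition R × Noncrossing R

Singleton : ∀ {n} → Mat n → Fin n → Set
Singleton {n} R i = ∀ (x : Fin n) → R ∋[ i , x ] → x ≡ i

merge : ∀ {n} → Mat n → Fin n → Fin n → Mat n
merge R i j = tabulate λ a → tabulate λ b →
  lookup (lookup R a) b
  ∨ (⌊ a Fin.≟ i ⌋ ∧ ⌊ b Fin.≟ j ⌋)
  ∨ (⌊ a Fin.≟ j ⌋ ∧ ⌊ b Fin.≟ i ⌋)

MarriageableSingles : ∀ {n} → Mat n → Set
MarriageableSingles {n} R =
  NoncrossingPartition R ×
  ∃[ i ] ∃[ j ] (i ≢ j × Singleton R i × Singleton R j ×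
                 NoncrossingPartition (merge R i j))

-- Standard road intersection of size n: 2n points on a circle, clockwise
-- E_1, X_1, ..., E_n, X_n.

posE posX : ∀ {n} → Fin n → ℕ
posE i = 2 * toℕ i
posX i = 2 * toℕ i + 1

Lane : ℕ → Set
Lane n = Fin n × Fin n   -- (i , j) is the chord E_i X_j

Between : ℕ → ℕ → ℕ → Set
Between x p q = (p ℕ.< x × x ℕ.< q) ⊎ (q ℕ.< x × x ℕ.< p)

-- Two straight chords between points on a circle have a common point iff
-- they share an endpoint or their endpoints interleave around the circle.
ChordsCross : ℕ → ℕ → ℕ → ℕ → Set
ChordsCross p q r s =
  (p ≡ r ⊎ p ≡ s ⊎ q ≡ r ⊎ q ≡ s) ⊎
  (Between r p q × ¬ Between s p q) ⊎
  (¬ Between r p q × Between s p q)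

Cross : ∀ {n} → Lane n → Lane n → Set
Cross (i , j) (k , l) = ChordsCross (posE i) (posX j) (posE k) (posX l)

_∋L_ : ∀ {n} → Mat n → Lane n → Set
S ∋L (i , j) = S ∋[ i , j ]

MSL : ∀ {n} → Mat n → Set
MSL {n} S =
  (∀ (l l' : Lane n) → S ∋L l → S ∋L l' → l ≢ l' → ¬ Cross l l') ×
  (∀ (l : Lane n) → ¬ (S ∋L l) → ∃[ l' ] (S ∋L l' × Cross l l'))

swapU : ∀ {n} → Mat n → Fin n → Fin n → Mat n
swapU S i j = tabulate λ a → tabulate λ b →
  if (⌊ a Fin.≟ i ⌋ ∧ ⌊ b Fin.≟ i ⌋) ∨ (⌊ a Fin.≟ j ⌋ ∧ ⌊ b Fin.≟ j ⌋)
  then false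
  else (if (⌊ a Fin.≟ i ⌋ ∧ ⌊ b Fin.≟ j ⌋) ∨ (⌊ a Fin.≟ j ⌋ ∧ ⌊ b Fin.≟ i ⌋)
        then true
        else lookup (lookup S a) b)

NonabsoluteMSL : ∀ {n} → Mat n → Set
NonabsoluteMSL {n} S =
  MSL S ×
  ∃[ i ] ∃[ j ] (i ≢ j × S ∋[ i , i ] × S ∋[ j , j ] × MSL (swapU S i j))

{-# OPTIONS --safe #-}
-- A noncrossing partition R of [n] yields the lanes E_a X_b with b the cyclic
-- predecessor of a in its block (toLanes R); a set of lanes S yields the
-- partition in which x and y are related when no lane of S separates the arcs
-- E_x X_x and E_y X_y (toPartition S). These maps are mutually inverse between
-- noncrossing partitions and MSLs, U-turns E_i X_i correspond to singleton
-- blocks {i}, and merging two singleton blocks {i}, {j} replaces exactly the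
-- U-turns E_i X_i, E_j X_j by E_i X_j, E_j X_i. So toLanes maps marriageable
-- singles partitions bijectively onto nonabsolute MSLs. For surjectivity the
-- merged relation must be noncrossing: it has the same lanes as the partition
-- recovered from the swapped MSL, and a partition is determined by its lanes
-- once one of the two partitions compared is noncrossing.
module Submission where

open import Defs
open import Data.Bool using (Bool; true; false; _∨_; _∧_; if_then_else_)
import Data.Bool.Properties as Boolₚ
open import Data.Empty using (⊥-elim)
open import Data.Fin as Fin using (Fin; toℕ; _<?_; _≤?_; _≟_)
import Data.Fin.Properties as Finₚ
open import Data.List using (List; []; _∷_; length; map; filter; cartesianProductWith)
open import Data.List.Properties using (length-map)
open import Data.List.Membership.Propositional using (_∈_)
open import Data.List.Membership.Propositional.Properties
  using (∈-filter⁺; ∈-filter⁻; ∈-map⁺; ∈-map⁻; ∈-cartesianProductWith⁺)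
open import Data.List.Relation.Unary.All as All using (All; []; _∷_)
open import Data.List.Relation.Unary.Any using (here; there)
open import Data.List.Relation.Unary.AllPairs using ([]; _∷_)
open import Data.List.Relation.Unary.Unique.Propositional using (Unique)
import Data.List.Relation.Unary.Unique.Propositional.Properties as Uniqueₚ
open import Data.Nat as ℕ using (ℕ; zero; suc; z≤n; s≤s)
import Data.Nat.Properties as ℕₚ
open import Data.Product using (∃-syntax; _×_; _,_; proj₁; proj₂)
open import Data.Sum using (_⊎_; inj₁; inj₂)
open import Data.Vec using (Vec; []; _∷_; lookup; tabulate)
open import Data.Vec.Properties using (lookup∘tabulate; tabulate∘lookup; tabulate-cong; ∷-injective)
open import Function.Base using (_∘′_)
open import Function.Bundles using (_⇔_; mk⇔; Equivalence)
open import Relation.Binary using (tri<; tri≈; tri>)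
open import Relation.Binary.PropositionalEquality using (_≡_; _≢_; refl; sym; trans; cong; subst)
open import Relation.Nullary using (¬_; Dec; yes; no)
open import Relation.Nullary.Decidable
  using (⌊_⌋; isYes≗does; toWitness; dec-true; dec-false; does-⇔; map′; decidable-stable;
         _×-dec_; _⊎-dec_; _→-dec_; ¬?)
open import Relation.Unary using (Decidable)

private variable
  n : ℕ

module _ {A : Set} where

  vectors : List A → (m : ℕ) → List (Vec A m)
  vectors xs zero    = [] ∷ []
  vectors xs (suc m) = cartesianProductWith _∷_ xs (vectors xs m)

  ∈-vectors : ∀ {xs} → (∀ x → x ∈ xs) → ∀ {m} (v : Vec A m) → v ∈ vectors xs m
  ∈-vectors _    []      = here refl
  ∈-vectors ∈xs (x ∷ v) = ∈-cartesianProductWith⁺ _∷_ (∈xs x) (∈-vectors ∈xs v)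

  vectors-unique : ∀ {xs} → Unique xs → ∀ m → Unique (vectors xs m)
  vectors-unique _ zero    = [] ∷ []
  vectors-unique u (suc m) = Uniqueₚ.cartesianProductWith⁺ _∷_ ∷-injective u (vectors-unique u m)


matrices : ∀ n → List (Mat n)
matrices n = vectors (vectors (true ∷ false ∷ []) n) n

∈-matrices : (M : Mat n) → M ∈ matrices n
∈-matrices = ∈-vectors (∈-vectors λ { true → here refl ; false → there (here refl) })

matrices-unique : ∀ n → Unique (matrices n)
matrices-unique n = vectors-unique (vectors-unique (((λ ()) ∷ []) ∷ [] ∷ []) n) n

decidable⇒HasCard : {P : Mat n → Set} → Decidable P → ∃[ k ] HasCard P k
decidable⇒HasCard {n} P? =
  _ , filter P? (matrices n) , Uniqueₚ.filter⁺ P? (matrices-unique n) ,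
  (λ M → mk⇔ (λ M∈ → proj₂ (∈-filter⁻ P? {xs = matrices n} M∈)) (∈-filter⁺ P? (∈-matrices M))) ,
  refl

module _ {A B : Set} {P : A → Set} {Q : B → Set} (f : A → B)
         (inj : ∀ {x y} → P x → P y → f x ≡ f y → x ≡ y) where

  Unique-map : ∀ {xs} → All P xs → Unique xs → Unique (map f xs)
  Unique-map []         []       = []
  Unique-map (px ∷ pxs) (x∉ ∷ u) = distinct px pxs x∉ ∷ Unique-map pxs u
    where
    distinct : ∀ {x ys} → P x → All P ys → All (x ≢_) ys → All (f x ≢_) (map f ys)
    distinct px []         []         = []
    distinct px (py ∷ pys) (x≢y ∷ ne) = (λ e → x≢y (inj px py e)) ∷ distinct px pys ne

  HasCard-bijection : (∀ {x} → P x → Q (f x)) → (∀ {y} → Q y → ∃[ x ] (P x × f x ≡ y)) →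
                      ∀ {k} → HasCard P k → HasCard Q k
  HasCard-bijection pres surj (xs , u , xs⇔P , len) =
    map f xs ,
    Unique-map (All.tabulate λ {x} → Equivalence.to (xs⇔P x)) u ,
    (λ y → mk⇔ (λ y∈ → let x , x∈ , y≡fx = ∈-map⁻ f y∈
                        in subst Q (sym y≡fx) (pres (Equivalence.to (xs⇔P x) x∈)))
               (λ Qy → let x , Px , fx≡y = surj Qy
                       in subst (_∈ map f xs) fx≡y (∈-map⁺ f (Equivalence.from (xs⇔P x) Px)))) ,
    trans (length-map f xs) len

⌊⌋-true : ∀ {P : Set} (P? : Dec P) → P → ⌊ P? ⌋ ≡ true
⌊⌋-true P? p = trans (isYes≗does P?) (dec-true P? p)

⌊⌋-false : ∀ {P : Set} (P? : Dec P) → ¬ P → ⌊ P? ⌋ ≡ false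
⌊⌋-false P? ¬p = trans (isYes≗does P?) (dec-false P? ¬p)

⌊⌋-true⁻ : ∀ {P : Set} (P? : Dec P) → ⌊ P? ⌋ ≡ true → P
⌊⌋-true⁻ P? e = toWitness {a? = P?} (Equivalence.from Boolₚ.T-≡ e)

⌊⌋-⇔ : ∀ {P Q : Set} → P ⇔ Q → (P? : Dec P) (Q? : Dec Q) → ⌊ P? ⌋ ≡ ⌊ Q? ⌋
⌊⌋-⇔ P⇔Q P? Q? = trans (isYes≗does P?) (trans (does-⇔ P⇔Q P? Q?) (sym (isYes≗does Q?)))

∨-≡-true⁻ : ∀ {u v : Bool} → (u ∨ v) ≡ true → u ≡ true ⊎ v ≡ true
∨-≡-true⁻ {true}  _ = inj₁ refl
∨-≡-true⁻ {false} e = inj₂ e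

∧-≡-true⁻ : ∀ {u v : Bool} → (u ∧ v) ≡ true → u ≡ true × v ≡ true
∧-≡-true⁻ {true} {true} _ = refl , refl

greatest : {P : Fin n → Set} → Decidable P → ∀ {x} → P x → ∃[ m ] (P m × ∀ y → P y → y Fin.≤ m)
greatest {suc n} {P} P? px with Finₚ.any? (λ y → P? (Fin.suc y))
... | yes (y , py) =
  let m , pm , m-max = greatest (λ y → P? (Fin.suc y)) py
  in Fin.suc m , pm , λ { Fin.zero _ → z≤n ; (Fin.suc y) py → s≤s (m-max y py) }
greatest {suc n} {P} P? {Fin.zero} p0 | no ¬P∘suc =
  Fin.zero , p0 , λ { Fin.zero _ → z≤n ; (Fin.suc y) py → ⊥-elim (¬P∘suc (y , py)) }
greatest {suc n} {P} P? {Fin.suc x} px | no ¬P∘suc = ⊥-elim (¬P∘suc (x , px))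

least : {P : Fin n → Set} → Decidable P → ∀ {x} → P x → ∃[ m ] (P m × ∀ y → P y → m Fin.≤ y)
least {suc n} {P} P? px with P? Fin.zero
... | yes p0 = Fin.zero , p0 , λ _ _ → z≤n
least {suc n} {P} P? {Fin.zero}  p0 | no ¬p0 = ⊥-elim (¬p0 p0)
least {suc n} {P} P? {Fin.suc x} px | no ¬p0 =
  let m , pm , m-min = least (λ y → P? (Fin.suc y)) px
  in Fin.suc m , pm , λ { Fin.zero p0 → ⊥-elim (¬p0 p0) ; (Fin.suc y) py → s≤s (m-min y py) }

module _ {n : ℕ} where
  open import Data.Fin using (_<_; _≤_)

  private variable
    a b c d i j m p q s x y z : Fin n
    R R₁ R₂ S : Mat n

  posX≡suc∘posE : (i : Fin n) → posX i ≡ suc (posE i)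
  posX≡suc∘posE i = ℕₚ.+-comm (posE i) 1

  posE-mono-< : a < b → posE a ℕ.< posE b
  posE-mono-< = ℕₚ.*-monoʳ-< 2

  posE-cancel-< : posE a ℕ.< posE b → a < b
  posE-cancel-< = ℕₚ.*-cancelˡ-< 2 _ _

  posE-injective : posE a ≡ posE b → a ≡ b
  posE-injective e = Finₚ.toℕ-injective (ℕₚ.*-cancelˡ-≡ _ _ 2 e)

  posX-mono-< : a < b → posX a ℕ.< posX b
  posX-mono-< = ℕₚ.+-monoˡ-< 1 ∘′ posE-mono-<

  posX-cancel-< : posX a ℕ.< posX b → a < b
  posX-cancel-< lt = posE-cancel-< (ℕₚ.+-cancelʳ-< 1 _ _ lt)

  posX-injective : posX a ≡ posX b → a ≡ b
  posX-injective e = posE-injective (ℕₚ.+-cancelʳ-≡ 1 _ _ e)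

  posE≢posX : (a b : Fin n) → posE a ≢ posX b
  posE≢posX a b e = ℕₚ.even≢odd (toℕ a) (toℕ b) (trans e (posX≡suc∘posE b))

  posE<posX⁺ : a ≤ b → posE a ℕ.< posX b
  posE<posX⁺ {b = b} a≤b rewrite posX≡suc∘posE b = s≤s (ℕₚ.*-monoʳ-≤ 2 a≤b)

  posE<posX⁻ : posE a ℕ.< posX b → a ≤ b
  posE<posX⁻ {b = b} lt rewrite posX≡suc∘posE b = ℕₚ.*-cancelˡ-≤ 2 (ℕₚ.m<1+n⇒m≤n lt)

  posX<posE⁺ : b < a → posX b ℕ.< posE a
  posX<posE⁺ {b = b} {a = a} b<a rewrite posX≡suc∘posE b =
    ℕₚ.≤∧≢⇒< (posE-mono-< b<a) (λ e → posE≢posX a b (sym (trans (posX≡suc∘posE b) e)))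

  posX<posE⁻ : posX b ℕ.< posE a → b < a
  posX<posE⁻ {b = b} lt rewrite posX≡suc∘posE b = posE-cancel-< (ℕₚ.<-trans (ℕₚ.n<1+n _) lt)

  entry? : (M : Mat n) (a b : Fin n) → Dec (M ∋[ a , b ])
  entry? M a b = lookup (lookup M a) b Boolₚ.≟ true

  lookup∘tabulate² : (f : Fin n → Fin n → Bool) (a b : Fin n) →
                     lookup (lookup (tabulate λ x → tabulate (f x)) a) b ≡ f a b
  lookup∘tabulate² f a b rewrite lookup∘tabulate (λ x → tabulate (f x)) a = lookup∘tabulate (f a) b

  Mat-≡ : ∀ {M N : Mat n} → (∀ a b → lookup (lookup M a) b ≡ lookup (lookup N a) b) → M ≡ N
  Mat-≡ {M} {N} M≗N = vec-ext λ a → vec-ext (M≗N a)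
    where
    vec-ext : ∀ {A : Set} {u v : Vec A n} → (∀ i → lookup u i ≡ lookup v i) → u ≡ v
    vec-ext {u = u} {v} u≗v = trans (sym (tabulate∘lookup u)) (trans (tabulate-cong u≗v) (tabulate∘lookup v))

  Mat-ext : ∀ {M N : Mat n} → (∀ a b → M ∋[ a , b ] → N ∋[ a , b ]) →
            (∀ a b → N ∋[ a , b ] → M ∋[ a , b ]) → M ≡ N
  Mat-ext M⊆N N⊆M = Mat-≡ λ a b → bool-ext (M⊆N a b) (N⊆M a b)
    where
    bool-ext : ∀ {u v : Bool} → (u ≡ true → v ≡ true) → (v ≡ true → u ≡ true) → u ≡ v
    bool-ext {true}  {v}     f _ = sym (f refl)
    bool-ext {false} {true}  _ g = g refl
    bool-ext {false} {false} _ _ = refl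

  decMat : {P : Fin n → Fin n → Set} → (∀ a b → Dec (P a b)) → Mat n
  decMat P? = tabulate λ a → tabulate λ b → ⌊ P? a b ⌋

  ∋-decMat⁺ : {P : Fin n → Fin n → Set} (P? : ∀ a b → Dec (P a b)) → P a b → decMat P? ∋[ a , b ]
  ∋-decMat⁺ {a = a} {b} P? p = trans (lookup∘tabulate² _ a b) (⌊⌋-true (P? a b) p)

  ∋-decMat⁻ : {P : Fin n → Fin n → Set} (P? : ∀ a b → Dec (P a b)) → decMat P? ∋[ a , b ] → P a b
  ∋-decMat⁻ {a = a} {b} P? e = ⌊⌋-true⁻ (P? a b) (trans (sym (lookup∘tabulate² _ a b)) e)

  module PartitionLaws {R : Mat n} (R-partition : IsPartition R) where

    reflexive : ∀ a → R ∋[ a , a ]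
    reflexive = proj₁ R-partition

    symmetric : R ∋[ a , b ] → R ∋[ b , a ]
    symmetric = proj₁ (proj₂ R-partition) _ _

    transitive : R ∋[ a , b ] → R ∋[ b , c ] → R ∋[ a , c ]
    transitive = proj₂ (proj₂ R-partition) _ _ _

  data CyclicPred (R : Mat n) (a : Fin n) : Fin n → Set where
    below : ∀ {b} → b < a → R ∋[ a , b ] → (∀ x → R ∋[ a , x ] → x < a → x ≤ b) → CyclicPred R a b
    wrap  : ∀ {b} → R ∋[ a , b ] → (∀ x → R ∋[ a , x ] → a ≤ x) → (∀ x → R ∋[ a , x ] → x ≤ b) →
            CyclicPred R a b

  cyclicPred? : (R : Mat n) (a b : Fin n) → Dec (CyclicPred R a b)
  cyclicPred? R a b = map′ fromSum toSum
    ((b <? a ×-dec entry? R a b ×-dec Finₚ.all? λ x → entry? R a x →-dec x <? a →-dec x ≤? b)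
     ⊎-dec (entry? R a b ×-dec (Finₚ.all? λ x → entry? R a x →-dec a ≤? x)
                         ×-dec Finₚ.all? λ x → entry? R a x →-dec x ≤? b))
    where
    Below Wrap : Set
    Below = b < a × R ∋[ a , b ] × (∀ x → R ∋[ a , x ] → x < a → x ≤ b)
    Wrap  = R ∋[ a , b ] × (∀ x → R ∋[ a , x ] → a ≤ x) × (∀ x → R ∋[ a , x ] → x ≤ b)
    fromSum : Below ⊎ Wrap → CyclicPred R a b
    fromSum (inj₁ (b<a , Rab , max)) = below b<a Rab max
    fromSum (inj₂ (Rab , min , max)) = wrap Rab min max
    toSum : CyclicPred R a b → Below ⊎ Wrap
    toSum (below b<a Rab max) = inj₁ (b<a , Rab , max)
    toSum (wrap Rab min max)  = inj₂ (Rab , min , max)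

  cyclicPred⇒∋ : CyclicPred R a b → R ∋[ a , b ]
  cyclicPred⇒∋ (below _ Rab _) = Rab
  cyclicPred⇒∋ (wrap Rab _ _)  = Rab

  cyclicPred-unique : CyclicPred R a p → CyclicPred R a q → p ≡ q
  cyclicPred-unique (below p<a Rap maxp) (below q<a Raq maxq) =
    Finₚ.≤-antisym (maxq _ Rap p<a) (maxp _ Raq q<a)
  cyclicPred-unique (below p<a Rap _)    (wrap _ min _)       = ⊥-elim (ℕₚ.<⇒≱ p<a (min _ Rap))
  cyclicPred-unique (wrap _ min _)       (below q<a Raq _)    = ⊥-elim (ℕₚ.<⇒≱ q<a (min _ Raq))
  cyclicPred-unique (wrap Rap _ maxp)    (wrap Raq _ maxq)    = Finₚ.≤-antisym (maxq _ Rap) (maxp _ Raq)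

  cyclicPred-injective : IsPartition R → CyclicPred R a p → CyclicPred R c p → a ≡ c
  cyclicPred-injective {R = R} {a = a} {c = c} R-partition predA predC =
    go predA predC (transitive (cyclicPred⇒∋ predA) (symmetric (cyclicPred⇒∋ predC)))
    where
    open PartitionLaws {R = R} R-partition
    go : CyclicPred R a p → CyclicPred R c p → R ∋[ a , c ] → a ≡ c
    go (below p<a _ maxA) (below p<c _ maxC) Rac with Finₚ.<-cmp a c
    ... | tri< a<c _ _ = ⊥-elim (ℕₚ.<⇒≱ p<a (maxC a (symmetric Rac) a<c))
    ... | tri≈ _ a≡c _ = a≡c
    ... | tri> _ _ c<a = ⊥-elim (ℕₚ.<⇒≱ p<c (maxA c Rac c<a))
    go (below p<a _ _)   (wrap _ _ maxC)   Rac = ⊥-elim (ℕₚ.<⇒≱ p<a (maxC a (symmetric Rac)))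
    go (wrap _ _ maxA)   (below p<c _ _)   Rac = ⊥-elim (ℕₚ.<⇒≱ p<c (maxA c Rac))
    go (wrap _ minA _)   (wrap _ minC _)   Rac = Finₚ.≤-antisym (minA c Rac) (minC a (symmetric Rac))

  cyclicPred-exists : IsPartition R → ∀ a → ∃[ p ] CyclicPred R a p
  cyclicPred-exists {R = R} R-partition a with Finₚ.any? (λ x → entry? R a x ×-dec x <? a)
  ... | yes (x , below-a) =
    let p , (Rap , p<a) , max = greatest (λ x → entry? R a x ×-dec x <? a) below-a
    in p , below p<a Rap λ y Ray y<a → max y (Ray , y<a)
  ... | no ¬below-a =
    let p , Rap , max = greatest (entry? R a) (reflexive a)
    in p , wrap Rap (λ y Ray → ℕₚ.≮⇒≥ λ y<a → ¬below-a (y , Ray , y<a)) max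
    where open PartitionLaws {R = R} R-partition

  cyclicSucc-exists : IsPartition R → ∀ p → ∃[ a ] CyclicPred R a p
  cyclicSucc-exists {R = R} R-partition p with Finₚ.any? (λ x → entry? R p x ×-dec p <? x)
  ... | yes (x , above-p) =
    let a , (Rpa , p<a) , min = least (λ x → entry? R p x ×-dec p <? x) above-p
    in a , below p<a (symmetric Rpa)
                 λ y Ray y<a → ℕₚ.≮⇒≥ λ p<y → ℕₚ.<⇒≱ y<a (min y (transitive Rpa Ray , p<y))
    where open PartitionLaws {R = R} R-partition
  ... | no ¬above-p =
    let a , Rpa , min = least (entry? R p) (reflexive p)
    in a , wrap (symmetric Rpa) (λ y Ray → min y (transitive Rpa Ray))
                (λ y Ray → ℕₚ.≮⇒≥ λ p<y → ¬above-p (y , transitive Rpa Ray , p<y))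
    where open PartitionLaws {R = R} R-partition

  singleton⇒cyclicPred-self : IsPartition R → Singleton R i → CyclicPred R i i
  singleton⇒cyclicPred-self R-partition single =
    wrap (proj₁ R-partition _) (λ x Rix → ℕₚ.≤-reflexive (cong toℕ (sym (single x Rix))))
                               (λ x Rix → ℕₚ.≤-reflexive (cong toℕ (single x Rix)))

  cyclicPred-self⇒singleton : CyclicPred R i i → Singleton R i
  cyclicPred-self⇒singleton (below i<i _ _) = ⊥-elim (ℕₚ.<-irrefl refl i<i)
  cyclicPred-self⇒singleton (wrap _ min max) x Rix = Finₚ.≤-antisym (max x Rix) (min x Rix)

  toLanes : Mat n → Mat n
  toLanes R = decMat (cyclicPred? R)

  ∋-toLanes⁺ : ∀ R → CyclicPred R a b → toLanes R ∋[ a , b ]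
  ∋-toLanes⁺ R = ∋-decMat⁺ (cyclicPred? R)

  ∋-toLanes⁻ : ∀ R → toLanes R ∋[ a , b ] → CyclicPred R a b
  ∋-toLanes⁻ R = ∋-decMat⁻ (cyclicPred? R)

  -- The midpoint of the arc E_x X_x lies on the side of the chord E_c X_d
  -- that does not contain the midpoint of the arc X_{n-1} E_0.
  Inside : Lane n → Fin n → Set
  Inside (c , d) x = (d < c × d < x × x < c) ⊎ (c ≤ d × c ≤ x × x ≤ d)

  inside? : ∀ l x → Dec (Inside l x)
  inside? (c , d) x = (d <? c ×-dec d <? x ×-dec x <? c) ⊎-dec (c ≤? d ×-dec c ≤? x ×-dec x ≤? d)

  inside-convex : ∀ {l} → Inside l x → Inside l y → x ≤ m → m ≤ y → Inside l m
  inside-convex (inj₁ (d<c , d<x , _)) (inj₁ (_ , _ , y<c)) x≤m m≤y =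
    inj₁ (d<c , ℕₚ.<-≤-trans d<x x≤m , ℕₚ.≤-<-trans m≤y y<c)
  inside-convex (inj₂ (c≤d , c≤x , _)) (inj₂ (_ , _ , y≤d)) x≤m m≤y =
    inj₂ (c≤d , ℕₚ.≤-trans c≤x x≤m , ℕₚ.≤-trans m≤y y≤d)
  inside-convex (inj₁ (d<c , _)) (inj₂ (c≤d , _)) _ _ = ⊥-elim (ℕₚ.<⇒≱ d<c c≤d)
  inside-convex (inj₂ (c≤d , _)) (inj₁ (d<c , _)) _ _ = ⊥-elim (ℕₚ.<⇒≱ d<c c≤d)

  SameSideOf : Lane n → Fin n → Fin n → Set
  SameSideOf l x y = (Inside l x → Inside l y) × (Inside l y → Inside l x)

  sameSideOf-endpoints : SameSideOf (x , y) x y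
  sameSideOf-endpoints = to , from
    where
    to : Inside (x , y) x → Inside (x , y) y
    to (inj₁ (_ , _ , x<x)) = ⊥-elim (ℕₚ.<-irrefl refl x<x)
    to (inj₂ (x≤y , _))     = inj₂ (x≤y , x≤y , ℕₚ.≤-refl)
    from : Inside (x , y) y → Inside (x , y) x
    from (inj₁ (_ , y<y , _)) = ⊥-elim (ℕₚ.<-irrefl refl y<y)
    from (inj₂ (x≤y , _))     = inj₂ (x≤y , ℕₚ.≤-refl , x≤y)

  SameSide : Mat n → Fin n → Fin n → Set
  SameSide S x y = ∀ c d → S ∋[ c , d ] → SameSideOf (c , d) x y

  sameSide? : (S : Mat n) (x y : Fin n) → Dec (SameSide S x y)
  sameSide? S x y = Finₚ.all? λ c → Finₚ.all? λ d → entry? S c d →-dec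
    ((inside? (c , d) x →-dec inside? (c , d) y) ×-dec (inside? (c , d) y →-dec inside? (c , d) x))

  toPartition : Mat n → Mat n
  toPartition S = decMat (sameSide? S)

  ∋-toPartition⁺ : ∀ S → SameSide S x y → toPartition S ∋[ x , y ]
  ∋-toPartition⁺ S = ∋-decMat⁺ (sameSide? S)

  ∋-toPartition⁻ : ∀ S → toPartition S ∋[ x , y ] → SameSide S x y
  ∋-toPartition⁻ S = ∋-decMat⁻ (sameSide? S)

  toPartition-noncrossingPartition : ∀ S → NoncrossingPartition (toPartition S)
  toPartition-noncrossingPartition S =
    ( (λ x → ∋-toPartition⁺ S λ _ _ _ → (λ ix → ix) , (λ ix → ix))
    , (λ x y Rxy → ∋-toPartition⁺ S λ c d Scd → let to , from = ∋-toPartition⁻ S Rxy c d Scd in from , to)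
    , (λ x y z Rxy Ryz → ∋-toPartition⁺ S λ c d Scd →
         let to₁ , from₁ = ∋-toPartition⁻ S Rxy c d Scd
             to₂ , from₂ = ∋-toPartition⁻ S Ryz c d Scd
         in (λ ix → to₂ (to₁ ix)) , (λ iz → from₁ (from₂ iz))) )
    , λ a b c d Rab Rcd ¬Rac a<c c<b b<d → ¬Rac (∋-toPartition⁺ S λ e f Sef →
        let to₁ , from₁ = ∋-toPartition⁻ S Rab e f Sef
            to₂ , from₂ = ∋-toPartition⁻ S Rcd e f Sef
        in (λ ia → inside-convex ia (to₁ ia) (ℕₚ.<⇒≤ a<c) (ℕₚ.<⇒≤ c<b))
         , (λ ic → from₁ (inside-convex ic (to₂ ic) (ℕₚ.<⇒≤ c<b) (ℕₚ.<⇒≤ b<d))))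

  between? : ∀ x p q → Dec (Between x p q)
  between? x p q = (p ℕ.<? x ×-dec x ℕ.<? q) ⊎-dec (q ℕ.<? x ×-dec x ℕ.<? p)

  between-posE⇒inside : Between (posE x) (posE c) (posX d) → Inside (c , d) x
  between-posE⇒inside (inj₁ (Ec<Ex , Ex<Xd)) =
    let c<x = posE-cancel-< Ec<Ex ; x≤d = posE<posX⁻ Ex<Xd
    in inj₂ (ℕₚ.≤-trans (ℕₚ.<⇒≤ c<x) x≤d , ℕₚ.<⇒≤ c<x , x≤d)
  between-posE⇒inside (inj₂ (Xd<Ex , Ex<Ec)) =
    let d<x = posX<posE⁻ Xd<Ex ; x<c = posE-cancel-< Ex<Ec
    in inj₁ (ℕₚ.<-trans d<x x<c , d<x , x<c)

  inside⇒between-posE : x ≢ c → Inside (c , d) x → Between (posE x) (posE c) (posX d)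
  inside⇒between-posE _   (inj₁ (_ , d<x , x<c)) = inj₂ (posX<posE⁺ d<x , posE-mono-< x<c)
  inside⇒between-posE x≢c (inj₂ (_ , c≤x , x≤d)) =
    inj₁ (posE-mono-< (Finₚ.≤∧≢⇒< c≤x (x≢c ∘′ sym)) , posE<posX⁺ x≤d)

  between-posX⇒inside : Between (posX x) (posE c) (posX d) → Inside (c , d) x
  between-posX⇒inside (inj₁ (Ec<Xx , Xx<Xd)) =
    let c≤x = posE<posX⁻ Ec<Xx ; x<d = posX-cancel-< Xx<Xd
    in inj₂ (ℕₚ.≤-trans c≤x (ℕₚ.<⇒≤ x<d) , c≤x , ℕₚ.<⇒≤ x<d)
  between-posX⇒inside (inj₂ (Xd<Xx , Xx<Ec)) =
    let d<x = posX-cancel-< Xd<Xx ; x<c = posX<posE⁻ Xx<Ec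
    in inj₁ (ℕₚ.<-trans d<x x<c , d<x , x<c)

  inside⇒between-posX : x ≢ d → Inside (c , d) x → Between (posX x) (posE c) (posX d)
  inside⇒between-posX _   (inj₁ (_ , d<x , x<c)) = inj₂ (posX-mono-< d<x , posX<posE⁺ x<c)
  inside⇒between-posX x≢d (inj₂ (_ , c≤x , x≤d)) =
    inj₁ (posE<posX⁺ c≤x , posX-mono-< (Finₚ.≤∧≢⇒< x≤d x≢d))

  cross⇒¬sameSideOf : a ≢ c → p ≢ q → Cross (a , p) (c , q) → ¬ SameSideOf (a , p) c q
  cross⇒¬sameSideOf a≢c _   (inj₁ (inj₁ Ea≡Ec))               _ = a≢c (posE-injective Ea≡Ec)
  cross⇒¬sameSideOf {a = a} {q = q} _ _ (inj₁ (inj₂ (inj₁ Ea≡Xq))) _ = posE≢posX a q Ea≡Xq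
  cross⇒¬sameSideOf {c = c} {p = p} _ _ (inj₁ (inj₂ (inj₂ (inj₁ Xp≡Ec)))) _ = posE≢posX c p (sym Xp≡Ec)
  cross⇒¬sameSideOf _   p≢q (inj₁ (inj₂ (inj₂ (inj₂ Xp≡Xq)))) _ = p≢q (posX-injective Xp≡Xq)
  cross⇒¬sameSideOf _   p≢q (inj₂ (inj₁ (Ec-between , ¬Xq-between))) (to , _) =
    ¬Xq-between (inside⇒between-posX (p≢q ∘′ sym) (to (between-posE⇒inside Ec-between)))
  cross⇒¬sameSideOf a≢c _   (inj₂ (inj₂ (¬Ec-between , Xq-between))) (_ , from) =
    ¬Ec-between (inside⇒between-posE (a≢c ∘′ sym) (from (between-posX⇒inside Xq-between)))

  ¬cross⇒sameSideOf : x ≢ c → y ≢ d → ¬ Cross (c , d) (x , y) → SameSideOf (c , d) x y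
  ¬cross⇒sameSideOf {x = x} {c} {y} {d} x≢c y≢d ¬cross =
    (λ ix → between-posX⇒inside (decidable-stable (between? (posX y) (posE c) (posX d))
              λ ¬Xy-between → ¬cross (inj₂ (inj₁ (inside⇒between-posE x≢c ix , ¬Xy-between))))) ,
    (λ iy → between-posE⇒inside (decidable-stable (between? (posE x) (posE c) (posX d))
              λ ¬Ex-between → ¬cross (inj₂ (inj₂ (¬Ex-between , inside⇒between-posX y≢d iy)))))

  cyclicPred-inside-block : CyclicPred R c p → R ∋[ c , a ] → Inside (c , p) a →
                            R ∋[ c , b ] → Inside (c , p) b
  cyclicPred-inside-block (below _ _ max)   Rca (inj₁ (_ , p<a , a<c)) _ = ⊥-elim (ℕₚ.<⇒≱ p<a (max _ Rca a<c))
  cyclicPred-inside-block (below p<c _ _)   _   (inj₂ (c≤p , _))      _ = ⊥-elim (ℕₚ.<⇒≱ p<c c≤p)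
  cyclicPred-inside-block (wrap Rcp min max) _  _                    Rcb = inj₂ (min _ Rcp , min _ Rcb , max _ Rcb)

  module _ {R : Mat n} (R-ncp : NoncrossingPartition R) where
    open PartitionLaws {R = R} (proj₁ R-ncp)
    private
      noncrossing : Noncrossing R
      noncrossing = proj₂ R-ncp

    block-inside-chord : R ∋[ c , p ] → ¬ R ∋[ a , c ] → R ∋[ a , b ] →
                         Inside (c , p) a → Inside (c , p) b
    block-inside-chord {c} {p} {a} {b} Rcp ¬Rac Rab (inj₁ (p<c , p<a , a<c)) = inj₁ (p<c , p<b , b<c)
      where
      ¬Rap : ¬ R ∋[ a , p ]
      ¬Rap Rap = ¬Rac (transitive Rap (symmetric Rcp))
      p<b : p < b
      p<b with Finₚ.<-cmp b p
      ... | tri< b<p _ _ =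
        ⊥-elim (noncrossing b a p c (symmetric Rab) (symmetric Rcp) (¬Rap ∘′ transitive Rab) b<p p<a a<c)
      ... | tri≈ _ refl _ = ⊥-elim (¬Rap Rab)
      ... | tri> _ _ p<b = p<b
      b<c : b < c
      b<c with Finₚ.<-cmp b c
      ... | tri< b<c _ _ = b<c
      ... | tri≈ _ refl _ = ⊥-elim (¬Rac Rab)
      ... | tri> _ _ c<b = ⊥-elim (noncrossing p c a b (symmetric Rcp) Rab (¬Rap ∘′ symmetric) p<a a<c c<b)
    block-inside-chord {c} {p} {a} {b} Rcp ¬Rac Rab (inj₂ (c≤p , c≤a , a≤p)) = inj₂ (c≤p , c≤b , b≤p)
      where
      ¬Rap : ¬ R ∋[ a , p ]
      ¬Rap Rap = ¬Rac (transitive Rap (symmetric Rcp))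
      c<a : c < a
      c<a = Finₚ.≤∧≢⇒< c≤a λ { refl → ¬Rac (reflexive a) }
      a<p : a < p
      a<p = Finₚ.≤∧≢⇒< a≤p λ { refl → ¬Rap (reflexive a) }
      c≤b : c ≤ b
      c≤b with Finₚ.<-cmp b c
      ... | tri< b<c _ _ = ⊥-elim (noncrossing b a c p (symmetric Rab) Rcp (¬Rac ∘′ transitive Rab) b<c c<a a<p)
      ... | tri≈ _ refl _ = ⊥-elim (¬Rac Rab)
      ... | tri> _ _ c<b = ℕₚ.<⇒≤ c<b
      b≤p : b ≤ p
      b≤p with Finₚ.<-cmp b p
      ... | tri< b<p _ _ = ℕₚ.<⇒≤ b<p
      ... | tri≈ _ refl _ = ⊥-elim (¬Rap Rab)
      ... | tri> _ _ p<b = ⊥-elim (noncrossing c p a b Rcp Rab (¬Rac ∘′ symmetric) c<a a<p p<b)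

    cyclicPred-inside : CyclicPred R c p → R ∋[ a , b ] → Inside (c , p) a → Inside (c , p) b
    cyclicPred-inside {c = c} {a = a} pred Rab with entry? R a c
    ... | yes Rac = λ ia → cyclicPred-inside-block pred (symmetric Rac) ia (transitive (symmetric Rac) Rab)
    ... | no ¬Rac = block-inside-chord (cyclicPred⇒∋ pred) ¬Rac Rab

    toLanes-sameSide : R ∋[ a , b ] → SameSide (toLanes R) a b
    toLanes-sameSide Rab c p Lcp =
      let pred = ∋-toLanes⁻ R Lcp in cyclicPred-inside pred Rab , cyclicPred-inside pred (symmetric Rab)

    toLanes-MSL : MSL (toLanes R)
    toLanes-MSL = noncrossingLanes , maximal
      where
      noncrossingLanes : ∀ l l' → toLanes R ∋L l → toLanes R ∋L l' → l ≢ l' → ¬ Cross l l'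
      noncrossingLanes (a , p) (c , q) Lap Lcq l≢l' with ∋-toLanes⁻ R Lap | ∋-toLanes⁻ R Lcq | a ≟ c | p ≟ q
      ... | predA | predC | yes refl | _        = ⊥-elim (l≢l' (cong (a ,_) (cyclicPred-unique predA predC)))
      ... | predA | predC | no a≢c   | yes refl =
        ⊥-elim (l≢l' (cong (_, p) (cyclicPred-injective (proj₁ R-ncp) predA predC)))
      ... | _     | predC | no a≢c   | no p≢q  =
        λ cross → cross⇒¬sameSideOf a≢c p≢q cross (toLanes-sameSide (cyclicPred⇒∋ predC) a p Lap)
      maximal : ∀ l → ¬ toLanes R ∋L l → ∃[ l' ] (toLanes R ∋L l' × Cross l l')
      maximal (a , _) _ =
        let p , predA = cyclicPred-exists (proj₁ R-ncp) a
        in (a , p) , ∋-toLanes⁺ R predA , inj₁ (inj₁ refl)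

  module _ {R : Mat n} (R-partition : IsPartition R) where
    open PartitionLaws {R = R} R-partition

    lastBefore-separates : a < b → R ∋[ a , m ] → m < b → (∀ x → R ∋[ a , x ] → x < b → x ≤ m) →
                           ¬ R ∋[ a , b ] → CyclicPred R s m → ¬ SameSideOf (s , m) a b
    lastBefore-separates {a} {b} {m} {s} a<b Ram m<b max ¬Rab (below m<s Rsm _) (_ , from) =
      outside-a (from (inj₁ (m<s , m<b , b<s)))
      where
      Ras : R ∋[ a , s ]
      Ras = transitive Ram (symmetric Rsm)
      b<s : b < s
      b<s with Finₚ.<-cmp b s
      ... | tri< b<s _ _ = b<s
      ... | tri≈ _ refl _ = ⊥-elim (¬Rab Ras)
      ... | tri> _ _ s<b = ⊥-elim (ℕₚ.<⇒≱ m<s (max s Ras s<b))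
      outside-a : ¬ Inside (s , m) a
      outside-a (inj₁ (_ , m<a , _)) = ℕₚ.<⇒≱ m<a (max a (reflexive a) a<b)
      outside-a (inj₂ (s≤m , _))     = ℕₚ.<⇒≱ m<s s≤m
    lastBefore-separates {a} {b} {m} {s} _ Ram m<b _ _ (wrap Rsm min max) (to , _) =
      outside-b (to (inj₂ (min m Rsm , min a Rsa , max a Rsa)))
      where
      Rsa : R ∋[ s , a ]
      Rsa = transitive Rsm (symmetric Ram)
      outside-b : ¬ Inside (s , m) b
      outside-b (inj₁ (m<s , _))      = ℕₚ.<⇒≱ m<s (min m Rsm)
      outside-b (inj₂ (_ , _ , b≤m)) = ℕₚ.<⇒≱ m<b b≤m

    sameSide-toLanes⇒∋-< : a < b → SameSide (toLanes R) a b → R ∋[ a , b ]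
    sameSide-toLanes⇒∋-< {a} {b} a<b same with entry? R a b
    ... | yes Rab = Rab
    ... | no ¬Rab with greatest (λ x → entry? R a x ×-dec x <? b) (reflexive a , a<b)
    ...   | m , (Ram , m<b) , max with cyclicSucc-exists R-partition m
    ...     | s , pred = ⊥-elim (lastBefore-separates a<b Ram m<b (λ x Rax x<b → max x (Rax , x<b)) ¬Rab pred
                                    (same s m (∋-toLanes⁺ R pred)))

    sameSide-toLanes⇒∋ : SameSide (toLanes R) a b → R ∋[ a , b ]
    sameSide-toLanes⇒∋ {a} {b} same with Finₚ.<-cmp a b
    ... | tri< a<b _ _ = sameSide-toLanes⇒∋-< a<b same
    ... | tri≈ _ refl _ = reflexive a
    ... | tri> _ _ b<a = symmetric (sameSide-toLanes⇒∋-< b<a λ c d Lcd → let to , from = same c d Lcd in from , to)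

  module _ {S : Mat n} (S-noncrossing : ∀ l l' → S ∋L l → S ∋L l' → l ≢ l' → ¬ Cross l l') where

    lane-sameSide : S ∋[ x , y ] → SameSide S x y
    lane-sameSide {x} {y} Sxy c d Scd with c ≟ x | d ≟ y
    ... | yes refl | yes refl = sameSideOf-endpoints
    ... | yes refl | no d≢y   =
      ⊥-elim (S-noncrossing (c , d) (x , y) Scd Sxy (d≢y ∘′ cong proj₂) (inj₁ (inj₁ refl)))
    ... | no c≢x   | yes refl =
      ⊥-elim (S-noncrossing (c , d) (x , y) Scd Sxy (c≢x ∘′ cong proj₁) (inj₁ (inj₂ (inj₂ (inj₂ refl)))))
    ... | no c≢x   | no d≢y   =
      ¬cross⇒sameSideOf (c≢x ∘′ sym) (d≢y ∘′ sym)
        (S-noncrossing (c , d) (x , y) Scd Sxy (c≢x ∘′ cong proj₁))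

    lane⇒cyclicPred : S ∋[ x , y ] → CyclicPred (toPartition S) x y
    lane⇒cyclicPred {x} {y} Sxy with y <? x
    ... | yes y<x = below y<x (∋-toPartition⁺ S (lane-sameSide Sxy)) λ z Pxz z<x → ℕₚ.≮⇒≥ λ y<z →
                      x-outside (proj₂ (∋-toPartition⁻ S Pxz x y Sxy) (inj₁ (y<x , y<z , z<x)))
      where
      x-outside : ¬ Inside (x , y) x
      x-outside (inj₁ (_ , _ , x<x)) = ℕₚ.<-irrefl refl x<x
      x-outside (inj₂ (x≤y , _))     = ℕₚ.<⇒≱ y<x x≤y
    ... | no y≮x = wrap (∋-toPartition⁺ S (lane-sameSide Sxy)) (λ z Pxz → lower (inside z Pxz))
                                                              (λ z Pxz → upper (inside z Pxz))
      where
      x≤y : x ≤ y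
      x≤y = ℕₚ.≮⇒≥ y≮x
      inside : ∀ z → toPartition S ∋[ x , z ] → Inside (x , y) z
      inside z Pxz = proj₁ (∋-toPartition⁻ S Pxz x y Sxy) (inj₂ (x≤y , ℕₚ.≤-refl , x≤y))
      lower : Inside (x , y) z → x ≤ z
      lower (inj₁ (y<x , _))      = ⊥-elim (ℕₚ.<⇒≱ y<x x≤y)
      lower (inj₂ (_ , x≤z , _)) = x≤z
      upper : Inside (x , y) z → z ≤ y
      upper (inj₁ (y<x , _))      = ⊥-elim (ℕₚ.<⇒≱ y<x x≤y)
      upper (inj₂ (_ , _ , z≤y)) = z≤y

  toLanes-toPartition : MSL S → toLanes (toPartition S) ≡ S
  toLanes-toPartition {S} (S-noncrossing , S-maximal) =
    Mat-ext (λ a b Lab → decidable-stable (entry? S a b) (λ ¬Sab → lane-notAbsent Lab ¬Sab))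
            (λ a b Sab → ∋-toLanes⁺ (toPartition S) (lane⇒cyclicPred {S = S} S-noncrossing Sab))
    where
    lane-notAbsent : toLanes (toPartition S) ∋[ a , b ] → ¬ ¬ S ∋[ a , b ]
    lane-notAbsent {a} {b} Lab ¬Sab =
      let l' , Sl' , cross = S-maximal (a , b) ¬Sab
      in proj₁ (toLanes-MSL (toPartition-noncrossingPartition S)) (a , b) l' Lab
           (∋-toLanes⁺ (toPartition S) (lane⇒cyclicPred {S = S} S-noncrossing Sl'))
           (λ ab≡l' → ¬Sab (subst (S ∋L_) (sym ab≡l') Sl')) cross

  data MergeEntry (R : Mat n) (i j : Fin n) : Fin n → Fin n → Set where
    old    : R ∋[ a , b ] → MergeEntry R i j a b
    new-ij : MergeEntry R i j i j
    new-ji : MergeEntry R i j j i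

  ∋-merge⁻ : ∀ R i j → merge R i j ∋[ a , b ] → MergeEntry R i j a b
  ∋-merge⁻ {a = a} {b} R i j e with ∨-≡-true⁻ (trans (sym (lookup∘tabulate² _ a b)) e)
  ... | inj₁ Rab = old Rab
  ... | inj₂ e′ with ∨-≡-true⁻ e′
  ...   | inj₁ e″ with ∧-≡-true⁻ e″
  ...     | a≡i , b≡j with ⌊⌋-true⁻ (a ≟ i) a≡i | ⌊⌋-true⁻ (b ≟ j) b≡j
  ...       | refl | refl = new-ij
  ∋-merge⁻ {a = a} {b} R i j e | inj₂ e′ | inj₂ e″ with ∧-≡-true⁻ e″
  ...     | a≡j , b≡i with ⌊⌋-true⁻ (a ≟ j) a≡j | ⌊⌋-true⁻ (b ≟ i) b≡i
  ...       | refl | refl = new-ji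

  ∋-merge⁺ : MergeEntry R i j a b → merge R i j ∋[ a , b ]
  ∋-merge⁺ {R = R} {i} {j} {a} {b} e = trans (lookup∘tabulate² _ a b) (entry e)
    where
    entry : MergeEntry R i j a b →
            (lookup (lookup R a) b ∨ (⌊ a ≟ i ⌋ ∧ ⌊ b ≟ j ⌋) ∨ (⌊ a ≟ j ⌋ ∧ ⌊ b ≟ i ⌋)) ≡ true
    entry (old Rab) rewrite Rab = refl
    entry new-ij rewrite ⌊⌋-true (i ≟ i) refl | ⌊⌋-true (j ≟ j) refl = Boolₚ.∨-zeroʳ _
    entry new-ji rewrite ⌊⌋-true (j ≟ j) refl | ⌊⌋-true (i ≟ i) refl =
      trans (cong (lookup (lookup R j) i ∨_) (Boolₚ.∨-zeroʳ _)) (Boolₚ.∨-zeroʳ _)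

  merge-isPartition : IsPartition R → Singleton R i → Singleton R j → IsPartition (merge R i j)
  merge-isPartition {R = R} {i} {j} R-partition single-i single-j =
    (λ a → ∋-merge⁺ {R = R} {i} {j} (old (reflexive a))) ,
    (λ a b e → ∋-merge⁺ (entry-sym (∋-merge⁻ R i j e))) ,
    (λ a b c e₁ e₂ → ∋-merge⁺ (entry-trans (∋-merge⁻ R i j e₁) (∋-merge⁻ R i j e₂)))
    where
    open PartitionLaws {R = R} R-partition
    entry-sym : MergeEntry R i j a b → MergeEntry R i j b a
    entry-sym (old Rab) = old (symmetric Rab)
    entry-sym new-ij    = new-ji
    entry-sym new-ji    = new-ij
    entry-trans : MergeEntry R i j a b → MergeEntry R i j b c → MergeEntry R i j a c
    entry-trans (old Rab) (old Rbc) = old (transitive Rab Rbc)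
    entry-trans (old Rai) new-ij with single-i _ (symmetric Rai)
    ... | refl = new-ij
    entry-trans (old Raj) new-ji with single-j _ (symmetric Raj)
    ... | refl = new-ji
    entry-trans new-ij (old Rjc) with single-j _ Rjc
    ... | refl = new-ij
    entry-trans new-ji (old Ric) with single-i _ Ric
    ... | refl = new-ji
    entry-trans new-ij new-ij = new-ij
    entry-trans new-ij new-ji = old (reflexive i)
    entry-trans new-ji new-ij = old (reflexive j)
    entry-trans new-ji new-ji = new-ji

  cyclicPred-of-pair : a ≢ b → (∀ x → R ∋[ a , x ] → x ≡ a ⊎ x ≡ b) → R ∋[ a , b ] →
                       CyclicPred R a b
  cyclicPred-of-pair {a} {b} a≢b row Rab with Finₚ.<-cmp b a
  ... | tri< b<a _ _ = below b<a Rab λ x Rax x<a → max-below (row x Rax) x<a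
    where
    max-below : x ≡ a ⊎ x ≡ b → x < a → x ≤ b
    max-below (inj₁ refl) x<x = ⊥-elim (ℕₚ.<-irrefl refl x<x)
    max-below (inj₂ refl) _   = ℕₚ.≤-refl
  ... | tri≈ _ b≡a _ = ⊥-elim (a≢b (sym b≡a))
  ... | tri> _ _ a<b = wrap Rab (λ x Rax → lower (row x Rax)) (λ x Rax → upper (row x Rax))
    where
    lower : x ≡ a ⊎ x ≡ b → a ≤ x
    lower (inj₁ refl) = ℕₚ.≤-refl
    lower (inj₂ refl) = ℕₚ.<⇒≤ a<b
    upper : x ≡ a ⊎ x ≡ b → x ≤ b
    upper (inj₁ refl) = ℕₚ.<⇒≤ a<b
    upper (inj₂ refl) = ℕₚ.≤-refl

  cyclicPred-resp-row : (∀ x → R₁ ∋[ a , x ] → R₂ ∋[ a , x ]) →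
                        (∀ x → R₂ ∋[ a , x ] → R₁ ∋[ a , x ]) →
                        CyclicPred R₁ a b → CyclicPred R₂ a b
  cyclicPred-resp-row to from (below b<a Rab max) = below b<a (to _ Rab) λ x Rax → max x (from x Rax)
  cyclicPred-resp-row to from (wrap Rab min max)  = wrap (to _ Rab) (λ x Rax → min x (from x Rax))
                                                                      (λ x Rax → max x (from x Rax))

  module _ {R : Mat n} {i j : Fin n} (R-partition : IsPartition R)
           (single-i : Singleton R i) (single-j : Singleton R j) (i≢j : i ≢ j) where

    private
      row-i : ∀ x → merge R i j ∋[ i , x ] → x ≡ i ⊎ x ≡ j
      row-i x e with ∋-merge⁻ R i j e
      ... | old Rix = inj₁ (single-i x Rix)
      ... | new-ij  = inj₂ refl
      ... | new-ji  = inj₁ refl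

      row-j : ∀ x → merge R i j ∋[ j , x ] → x ≡ j ⊎ x ≡ i
      row-j x e with ∋-merge⁻ R i j e
      ... | old Rjx = inj₁ (single-j x Rjx)
      ... | new-ij  = inj₁ refl
      ... | new-ji  = inj₂ refl

      row-other : a ≢ i → a ≢ j → ∀ x → merge R i j ∋[ a , x ] → R ∋[ a , x ]
      row-other a≢i a≢j x e with ∋-merge⁻ R i j e
      ... | old Rax = Rax
      ... | new-ij  = ⊥-elim (a≢i refl)
      ... | new-ji  = ⊥-elim (a≢j refl)

      pred-ij : CyclicPred (merge R i j) i j
      pred-ij = cyclicPred-of-pair i≢j row-i (∋-merge⁺ {R = R} new-ij)

      pred-ji : CyclicPred (merge R i j) j i
      pred-ji = cyclicPred-of-pair (i≢j ∘′ sym) row-j (∋-merge⁺ {R = R} new-ji)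

      entry : ∀ a b → ⌊ cyclicPred? (merge R i j) a b ⌋ ≡
        (if (⌊ a ≟ i ⌋ ∧ ⌊ b ≟ i ⌋) ∨ (⌊ a ≟ j ⌋ ∧ ⌊ b ≟ j ⌋) then false
         else (if (⌊ a ≟ i ⌋ ∧ ⌊ b ≟ j ⌋) ∨ (⌊ a ≟ j ⌋ ∧ ⌊ b ≟ i ⌋) then true
               else lookup (lookup (toLanes R) a) b))
      entry a b with a ≟ i | a ≟ j | b ≟ i | b ≟ j
      ... | yes refl | yes i≡j | _        | _        = ⊥-elim (i≢j i≡j)
      ... | yes refl | no _    | yes refl | _        =
        ⌊⌋-false (cyclicPred? _ i i) λ pred →
          i≢j (sym (cyclicPred-self⇒singleton pred j (cyclicPred⇒∋ pred-ij)))
      ... | yes refl | no _    | no _     | yes refl = ⌊⌋-true (cyclicPred? _ i j) pred-ij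
      ... | yes refl | no _    | no b≢i   | no b≢j   =
        trans (⌊⌋-false (cyclicPred? _ i b) λ pred → b≢j (cyclicPred-unique pred pred-ij))
              (sym (trans (lookup∘tabulate² _ i b) (⌊⌋-false (cyclicPred? R i b) λ pred →
                 b≢i (cyclicPred-unique pred (singleton⇒cyclicPred-self R-partition single-i)))))
      ... | no _     | yes refl | _       | yes refl =
        ⌊⌋-false (cyclicPred? _ j j) λ pred → i≢j (cyclicPred-self⇒singleton pred i (cyclicPred⇒∋ pred-ji))
      ... | no _     | yes refl | yes refl | no _    = ⌊⌋-true (cyclicPred? _ j i) pred-ji
      ... | no _     | yes refl | no b≢i   | no b≢j  =
        trans (⌊⌋-false (cyclicPred? _ j b) λ pred → b≢i (cyclicPred-unique pred pred-ji))
              (sym (trans (lookup∘tabulate² _ j b) (⌊⌋-false (cyclicPred? R j b) λ pred →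
                 b≢j (cyclicPred-unique pred (singleton⇒cyclicPred-self R-partition single-j)))))
      ... | no a≢i   | no a≢j   | _       | _       =
        trans (⌊⌋-⇔ (mk⇔ (cyclicPred-resp-row (row-other a≢i a≢j) (λ x → ∋-merge⁺ {R = R} ∘′ old))
                         (cyclicPred-resp-row (λ x → ∋-merge⁺ {R = R} ∘′ old) (row-other a≢i a≢j)))
                    (cyclicPred? _ a b) (cyclicPred? R a b))
              (sym (lookup∘tabulate² _ a b))

    toLanes-merge : toLanes (merge R i j) ≡ swapU (toLanes R) i j
    toLanes-merge = Mat-≡ λ a b →
      trans (lookup∘tabulate² _ a b) (trans (entry a b) (sym (lookup∘tabulate² _ a b)))

  module _ {R₁ R₂ : Mat n} (R₁-partition : IsPartition R₁)
           (R₁⊆R₂ : ∀ {a b} → R₁ ∋[ a , b ] → R₂ ∋[ a , b ])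
           (cyclicPred₁⊆₂ : ∀ {a b} → CyclicPred R₁ a b → CyclicPred R₂ a b) where
    private
      module R₁ = PartitionLaws {R = R₁} R₁-partition

    -- Let m be the last element of a's R₁-block below b and s its cyclic
    -- successor in R₁, hence also in R₂. Since b > m lies in the R₂-block of m,
    -- s ≤ b, so either s = b or s contradicts the choice of m.
    cyclicPred-⊆⇒⊇-< : IsPartition R₂ → a < b → R₂ ∋[ a , b ] → R₁ ∋[ a , b ]
    cyclicPred-⊆⇒⊇-< {a} {b} R₂-partition a<b R₂ab with entry? R₁ a b
    ... | yes R₁ab = R₁ab
    ... | no ¬R₁ab with greatest (λ x → entry? R₁ a x ×-dec x <? b) (R₁.reflexive a , a<b)
    ...   | m , (R₁am , m<b) , max₁ with cyclicSucc-exists R₁-partition m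
    ...     | s , pred₁ = separated (cyclicPred₁⊆₂ pred₁)
      where
      module R₂ = PartitionLaws {R = R₂} R₂-partition
      R₁as : R₁ ∋[ a , s ]
      R₁as = R₁.transitive R₁am (R₁.symmetric (cyclicPred⇒∋ pred₁))
      R₂sb : R₂ ∋[ s , b ]
      R₂sb = R₂.transitive (R₂.symmetric (R₁⊆R₂ R₁as)) R₂ab
      separated : CyclicPred R₂ s m → R₁ ∋[ a , b ]
      separated (below m<s _ max₂) with Finₚ.<-cmp b s
      ... | tri< b<s _ _ = ⊥-elim (ℕₚ.<⇒≱ m<b (max₂ b R₂sb b<s))
      ... | tri≈ _ refl _ = R₁as
      ... | tri> _ _ s<b = ⊥-elim (ℕₚ.<⇒≱ m<s (max₁ s (R₁as , s<b)))
      separated (wrap _ _ max₂) = ⊥-elim (ℕₚ.<⇒≱ m<b (max₂ b R₂sb))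

    cyclicPred-⊆⇒⊇ : IsPartition R₂ → R₂ ∋[ a , b ] → R₁ ∋[ a , b ]
    cyclicPred-⊆⇒⊇ {a} {b} R₂-partition R₂ab with Finₚ.<-cmp a b
    ... | tri< a<b _ _ = cyclicPred-⊆⇒⊇-< R₂-partition a<b R₂ab
    ... | tri≈ _ refl _ = R₁.reflexive a
    ... | tri> _ _ b<a =
      R₁.symmetric (cyclicPred-⊆⇒⊇-< R₂-partition b<a (PartitionLaws.symmetric {R = R₂} R₂-partition R₂ab))

  toLanes-injective : NoncrossingPartition R₁ → IsPartition R₂ → toLanes R₁ ≡ toLanes R₂ → R₁ ≡ R₂
  toLanes-injective {R₁} {R₂} R₁-ncp R₂-partition L₁≡L₂ =
    Mat-ext (λ _ _ → R₁⊆R₂)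
            (λ _ _ → cyclicPred-⊆⇒⊇ {R₁ = R₁} (proj₁ R₁-ncp) R₁⊆R₂ cyclicPred₁⊆₂ R₂-partition)
    where
    R₁⊆R₂ : R₁ ∋[ a , b ] → R₂ ∋[ a , b ]
    R₁⊆R₂ {a} {b} R₁ab =
      sameSide-toLanes⇒∋ {R = R₂} R₂-partition
        (subst (λ L → SameSide L a b) L₁≡L₂ (toLanes-sameSide {R = R₁} R₁-ncp R₁ab))
    cyclicPred₁⊆₂ : CyclicPred R₁ a b → CyclicPred R₂ a b
    cyclicPred₁⊆₂ {a} {b} pred = ∋-toLanes⁻ R₂ (subst (_∋[ a , b ]) L₁≡L₂ (∋-toLanes⁺ R₁ pred))

  isPartition? : (R : Mat n) → Dec (IsPartition R)
  isPartition? R =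
    Finₚ.all? (λ a → entry? R a a) ×-dec
    Finₚ.all? (λ a → Finₚ.all? λ b → entry? R a b →-dec entry? R b a) ×-dec
    Finₚ.all? (λ a → Finₚ.all? λ b → Finₚ.all? λ c → entry? R a b →-dec entry? R b c →-dec entry? R a c)

  noncrossing? : (R : Mat n) → Dec (Noncrossing R)
  noncrossing? R = Finₚ.all? λ a → Finₚ.all? λ b → Finₚ.all? λ c → Finₚ.all? λ d →
    entry? R a b →-dec entry? R c d →-dec ¬? (entry? R a c) →-dec
    a <? c →-dec c <? b →-dec b <? d →-dec no λ ()

  noncrossingPartition? : (R : Mat n) → Dec (NoncrossingPartition R)
  noncrossingPartition? R = isPartition? R ×-dec noncrossing? R

  singleton? : (R : Mat n) (i : Fin n) → Dec (Singleton R i)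
  singleton? R i = Finₚ.all? λ x → entry? R i x →-dec x ≟ i

  marriageableSingles? : (R : Mat n) → Dec (MarriageableSingles R)
  marriageableSingles? R = noncrossingPartition? R ×-dec Finₚ.any? λ i → Finₚ.any? λ j →
    ¬? (i ≟ j) ×-dec singleton? R i ×-dec singleton? R j ×-dec noncrossingPartition? (merge R i j)

  toLanes-marriageable : MarriageableSingles R → NonabsoluteMSL (toLanes R)
  toLanes-marriageable {R} (R-ncp , i , j , i≢j , single-i , single-j , merged-ncp) =
    toLanes-MSL {R = R} R-ncp , i , j , i≢j ,
    ∋-toLanes⁺ R (singleton⇒cyclicPred-self (proj₁ R-ncp) single-i) ,
    ∋-toLanes⁺ R (singleton⇒cyclicPred-self (proj₁ R-ncp) single-j) ,
    subst MSL (toLanes-merge {R = R} (proj₁ R-ncp) single-i single-j i≢j)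
              (toLanes-MSL {R = merge R i j} merged-ncp)

  toPartition-nonabsolute : NonabsoluteMSL S → MarriageableSingles (toPartition S)
  toPartition-nonabsolute {S} (S-msl , i , j , i≢j , Sii , Sjj , swapped-msl) =
    P-ncp , i , j , i≢j , single-i , single-j ,
    subst NoncrossingPartition swapped≡merged (toPartition-noncrossingPartition (swapU S i j))
    where
    P : Mat n
    P = toPartition S
    P-ncp : NoncrossingPartition P
    P-ncp = toPartition-noncrossingPartition S
    lanes-P≡S : toLanes P ≡ S
    lanes-P≡S = toLanes-toPartition {S = S} S-msl
    u-turn⇒singleton : S ∋[ a , a ] → Singleton P a
    u-turn⇒singleton {a} Saa =
      cyclicPred-self⇒singleton (∋-toLanes⁻ P (subst (_∋[ a , a ]) (sym lanes-P≡S) Saa))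
    single-i : Singleton P i
    single-i = u-turn⇒singleton Sii
    single-j : Singleton P j
    single-j = u-turn⇒singleton Sjj
    swapped≡merged : toPartition (swapU S i j) ≡ merge P i j
    swapped≡merged = toLanes-injective {R₁ = toPartition (swapU S i j)} {R₂ = merge P i j}
      (toPartition-noncrossingPartition (swapU S i j))
      (merge-isPartition {R = P} (proj₁ P-ncp) single-i single-j)
      (trans (toLanes-toPartition {S = swapU S i j} swapped-msl)
             (sym (trans (toLanes-merge {R = P} (proj₁ P-ncp) single-i single-j i≢j)
                         (cong (λ L → swapU L i j) lanes-P≡S))))

open import Data.Nat using (_≤_)

corollary17 : (n : ℕ) → 1 ≤ n →
    ∃[ k ] (HasCard (NonabsoluteMSL {n}) k × HasCard (MarriageableSingles {n}) k)
corollary17 n _ =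
  let k , card = decidable⇒HasCard marriageableSingles?
  in k , HasCard-bijection toLanes
           (λ {R₁} {R₂} ms₁ ms₂ →
              toLanes-injective {R₁ = R₁} {R₂ = R₂} (proj₁ ms₁) (proj₁ (proj₁ ms₂)))
           toLanes-marriageable
           (λ {S} na → toPartition S , toPartition-nonabsolute {S = S} na , toLanes-toPartition {S = S} (proj₁ na))
           card
     , card
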